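{- Let $\Pi.\phi$ be a false QBF in prenex conjunctive normal form, with universal variables $U$ and existential variables $E$. Let $\psi_\forall=\bigwedge_{\alpha\in A_i}\phi^\alpha$ be obtained by the application of the algorithm below to $\Pi.\phi$ (i.e. $A_i$ is one of the sets of universal assignments constructed during its execution), and let $\psi'_\forall$ be an unsatisfiable core of $\psi_\forall$ (a subset of its clauses that is unsatisfiable). Then there is a $\forall$Exp+Res refutation of $\Pi.\phi$ such that all clauses introduced by the axiom rule occur in $\psi'_\forall$. Algorithm: set $A_0:=\{\alpha_0\}$ for an arbitrary full assignment $\alpha_0\colon U\to\{\top,\bot\}$, $S_0:=\emptyset$, $i:=1$. Repeat: (a) check satisfiability of $\bigwedge_{\alpha\in A_{i-1}}\phi^\alpha$; if unsatisfiable return false, otherwise let $\tau$ be a satisfying assignment and set $S_i:=S_{i-1}\cup\{(\tau|_{E^\alpha})^{ -\alpha}\mid \alpha\in A_{i-1}\}$; (b) check satisfiability of $\bigwedge_{\sigma\in S_i}\lnot\phi^\sigma$; if unsatisfiable return true, otherwise let $\rho$ be a satisfying assignment and set $A_i:=A_{i-1}\cup\{(\rho|_{U^\sigma})^{ -\sigma}\mid\sigma\in S_i\}$; (c) increment $i$.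
   Context: A QBF in prenex conjunctive normal form is $\Pi.\phi$ where $\Pi=Q_1x_1\ldots Q_nx_n$ with $Q_i\in\{\forall,\exists\}$ and pairwise distinct variables, $X=\{x_1,\dots,x_n\}$, and $\phi$ is a conjunction of clauses over $X$; $U$ ($E$) is the set of universally (existentially) quantified variables, and $x_i<_\Pi x_j$ iff $i<j$. An assignment for $Y$ is $\sigma\colon Y\to\{\top,\bot,\epsilon\}$ ($\epsilon$ = unassigned), full if it never takes value $\epsilon$; $\sigma|_Z$ is its restriction to $Z$. Instantiation: for an assignment $\sigma$ on a subset of $X$ (extended by $\epsilon$), $\phi^\sigma$ (and likewise $C^\sigma$ for a clause $C$) is obtained by replacing every $x$ with $\sigma(x)\neq\epsilon$ by $\sigma(x)$ (with propositional simplification, so satisfied clauses disappear and false literals are removed), and every $x$ with $\sigma(x)=\epsilon$ by the annotated variable $x^\omega$, where $\omega=\sigma(x_{k_1})\cdots\sigma(x_{k_m})$ for $x_{k_1}<_\Pi\cdots<_\Pi x_{k_m}$ all variables preceding $x$, each $\epsilon$ contributing the empty word (empty annotation identifies $x^\omega$ with $x$). Annotated variables with the same name and annotation are the same variable; thus $\psi_\forall$ is a CNF over annotated existential variables consisting of the clauses $C^\alpha$, $C$ a clause of $\phi$, $\alpha\in A_i$. Write $x^\sigma$ for the variable replacing $x$ in $\phi^\sigma$, $E^\sigma=\{x^\sigma: x\in E,\sigma(x)=\epsilon\}$, $U^\sigma=\{x^\sigma:x\in U,\sigma(x)=\epsilon\}$; for an assignment $\tau$ to annotated variables, $\tau^{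 -\sigma}$ is $x\mapsto\tau(x^\sigma)$. The $\forall$Exp+Res calculus has two rules: the axiom rule, deriving $C^\alpha$ for any clause $C$ of $\phi$ and any full assignment $\alpha\colon U\to\{\top,\bot\}$; and the resolution rule, deriving $C_1\lor C_2$ from $C_1\lor x^\omega$ and $C_2\lor\lnot x^\omega$. A derivation is a sequence of clauses each obtained by the axiom rule or by resolution from earlier clauses; a refutation is a derivation of the empty clause. -}

module Defs where

open import Data.Nat using (ℕ)
open import Data.Bool using (Bool; true; false; not; if_then_else_; _∧_; _∨_)
open import Data.Maybe using (Maybe; just; nothing; Is-just)
import Data.Maybe as M
open import Data.Fin using (Fin; toℕ; _<_)
open import Data.List using (List; []; _∷_; _++_; map; catMaybes; take; length)
open import Data.Bool.ListAction using (any; all)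
import Data.List as L
open import Data.Vec using (Vec; []; _∷_; lookup; tabulate; toList)
open import Data.Product using (Σ; _×_; _,_; ∃)
open import Data.Sum using (_⊎_)
open import Data.List.Membership.Propositional using (_∈_)
open import Data.List.Relation.Unary.Any using (Any)
open import Data.List.Relation.Unary.All using (All)
open import Relation.Binary.PropositionalEquality using (_≡_; _≢_)
open import Relation.Nullary using (¬_)

-- QBFs in prenex CNF.  Variables are x₁ … xₙ, represented by Fin n;
-- the prefix lists the quantifier of each variable in prefix order,
-- so x <_Π y iff toℕ x < toℕ y.

data Quant : Set where
  ∀q ∃q : Quant

-- literal: (polarity , variable); polarity true = positive
Lit : ℕ → Set
Lit n = Bool × Fin n

Clause : ℕ → Set
Clause n = List (Lit n)

CNF : ℕ → Set
CNF n = List (Clause n)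

litB : Bool → Bool → Bool
litB p b = if p then b else not b

cnfVal : ∀ {n} → Vec Bool n → CNF n → Bool
cnfVal v φ = all (λ C → any (λ l → litB (Data.Product.proj₁ l) (lookup v (Data.Product.proj₂ l))) C) φ

-- standard semantics of a prefix applied to a Boolean function of
-- the full assignment (head of the vector = outermost variable)
qval : ∀ {k} → Vec Quant k → (Vec Bool k → Bool) → Bool
qval [] f = f []
qval (∀q ∷ qs) f = qval qs (λ v → f (true ∷ v)) ∧ qval qs (λ v → f (false ∷ v))
qval (∃q ∷ qs) f = qval qs (λ v → f (true ∷ v)) ∨ qval qs (λ v → f (false ∷ v))

IsFalseQBF : ∀ {n} → Vec Quant n → CNF n → Set
IsFalseQBF Q φ = qval Q (λ v → cnfVal v φ) ≡ false

-- Assignments σ : X → {⊤,⊥,ε}  (nothing = ε)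

PAsg : ℕ → Set
PAsg n = Vec (Maybe Bool) n

-- full assignment α : U → {⊤,⊥}, extended by ε on E
Compat : Quant → Maybe Bool → Set
Compat ∀q m = Is-just m
Compat ∃q m = m ≡ nothing

FullU : ∀ {n} → Vec Quant n → PAsg n → Set
FullU Q α = ∀ x → Compat (lookup Q x) (lookup α x)

AVar : ℕ → Set
AVar n = Fin n × List Bool

ALit : ℕ → Set
ALit n = Bool × AVar n

AClause : ℕ → Set
AClause n = List (ALit n)

annot : ∀ {n} → PAsg n → Fin n → List Bool
annot σ x = catMaybes (take (toℕ x) (toList σ))

-- C^σ : nothing if the clause is satisfied (disappears), otherwise
-- false literals removed and unassigned variables annotated
inst : ∀ {n} → PAsg n → Clause n → Maybe (AClause n)
inst σ [] = just []
inst σ ((p , x) ∷ C) with lookup σ x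
... | just b = if litB p b then nothing else inst σ C
... | nothing = M.map ((p , (x , annot σ x)) ∷_) (inst σ C)

AAsg : ℕ → Set
AAsg n = AVar n → Bool

SatC : ∀ {n} → AAsg n → AClause n → Set
SatC τ D = Any (λ l → litB (Data.Product.proj₁ l) (τ (Data.Product.proj₂ l)) ≡ true) D

FalsC : ∀ {n} → AAsg n → AClause n → Set
FalsC τ D = All (λ l → litB (Data.Product.proj₁ l) (τ (Data.Product.proj₂ l)) ≡ false) D

InExp : ∀ {n} → CNF n → List (PAsg n) → AClause n → Set
InExp {n} φ A D = Σ (PAsg n) λ α → α ∈ A × Σ (Clause n) λ C → C ∈ φ × inst α C ≡ just D

SatExp : ∀ {n} → CNF n → List (PAsg n) → AAsg n → Set
SatExp φ A τ = ∀ D → InExp φ A D → SatC τ D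

SatNeg : ∀ {n} → CNF n → List (PAsg n) → AAsg n → Set
SatNeg {n} φ S ρ = ∀ σ → σ ∈ S → Σ (Clause n) λ C → C ∈ φ × Σ (AClause n) λ D → inst σ C ≡ just D × FalsC ρ D

-- (ρ|_{V^σ})^{-σ} where V is the set of q-quantified variables:
-- x ↦ ρ(x^σ) if x is q-quantified and σ(x) = ε, and ε otherwise
pick : Quant → Quant → Maybe Bool → Bool → Maybe Bool
pick ∀q ∀q nothing b = just b
pick ∃q ∃q nothing b = just b
pick _ _ _ _ = nothing

pull : ∀ {n} → Quant → Vec Quant n → PAsg n → AAsg n → PAsg n
pull q Q σ ρ = tabulate (λ x → pick q (lookup Q x) (lookup σ x) (ρ (x , annot σ x)))

nextS : ∀ {n} → Vec Quant n → List (PAsg n) → List (PAsg n) → AAsg n → List (PAsg n)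
nextS Q A S τ = S ++ map (λ α → pull ∃q Q α τ) A

nextA : ∀ {n} → Vec Quant n → List (PAsg n) → List (PAsg n) → AAsg n → List (PAsg n)
nextA Q A S' ρ = A ++ map (λ σ → pull ∀q Q σ ρ) S'

-- Reached Q φ A S : (A, S) = (A_i, S_i) for some i in some run of the
-- (nondeterministic) algorithm
data Reached {n} (Q : Vec Quant n) (φ : CNF n) : List (PAsg n) → List (PAsg n) → Set where
  init : (α₀ : PAsg n) → FullU Q α₀ → Reached Q φ (α₀ ∷ []) []
  step : ∀ {A S} (τ ρ : AAsg n) → Reached Q φ A S → SatExp φ A τ →
         SatNeg φ (nextS Q A S τ) ρ →
         Reached Q φ (nextA Q A (nextS Q A S τ) ρ) (nextS Q A S τ)

-- clauses are sets of literals: equality up to membership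

_≈c_ : ∀ {n} → AClause n → AClause n → Set
C ≈c D = ∀ l → (l ∈ C → l ∈ D) × (l ∈ D → l ∈ C)

Unsat : ∀ {n} → List (AClause n) → Set
Unsat {n} ψ = ¬ (Σ (AAsg n) λ τ → All (SatC τ) ψ)

Resolvent : ∀ {n} → AClause n → AClause n → AClause n → Set
Resolvent {n} D₁ D₂ D = Σ (AVar n) λ x → (true , x) ∈ D₁ × (false , x) ∈ D₂ ×
  (∀ l → (l ∈ D → (l ∈ D₁ × l ≢ (true , x)) ⊎ (l ∈ D₂ × l ≢ (false , x)))
       × ((l ∈ D₁ × l ≢ (true , x)) ⊎ (l ∈ D₂ × l ≢ (false , x)) → l ∈ D))

data Justified {n} (Q : Vec Quant n) (φ : CNF n) (Allowed : AClause n → Set)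
               (ds : List (AClause n)) (k : Fin (length ds)) : Set where
  axiom : (C : Clause n) → C ∈ φ → (α : PAsg n) → FullU Q α →
          (D : AClause n) → inst α C ≡ just D → L.lookup ds k ≈c D →
          Allowed (L.lookup ds k) → Justified Q φ Allowed ds k
  resolution : (i j : Fin (length ds)) → i < k → j < k →
               Resolvent (L.lookup ds i) (L.lookup ds j) (L.lookup ds k) →
               Justified Q φ Allowed ds k

Refutation : ∀ {n} → Vec Quant n → CNF n → (AClause n → Set) → List (AClause n) → Set
Refutation Q φ Allowed ds =
  (∀ k → Justified Q φ Allowed ds k) × Σ (Fin (length ds)) λ k → L.lookup ds k ≡ []

-- Every universal assignment built by the algorithm is full, so each clause of ψ'_∀ is an
-- instance C^α of a clause of φ and may be introduced by the axiom rule.  The annotated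
-- variables make ψ'_∀ an ordinary propositional CNF, and resolution is refutationally
-- complete for it: by the semantic-tree argument, for every assignment τ and every list Vs
-- of variables there is a clause derivable from ψ'_∀ that τ falsifies and that avoids Vs;
-- taking Vs to be all variables of ψ'_∀ leaves only the empty clause.  Listing the
-- derivation tree in post-order gives a ∀Exp+Res refutation.
module Submission where

open import Defs
open import Data.Nat using (ℕ)
open import Data.Vec using (Vec)
open import Data.List using (List)
open import Data.Product using (Σ; _×_)
open import Data.List.Membership.Propositional using (_∈_)
open import Data.List.Relation.Unary.Any using (Any)

import Data.Nat as ℕ
open import Data.Bool using (Bool; true; false; not)
import Data.Bool.Properties as Bool
open import Data.Maybe using (just; nothing)
open import Data.Fin using (Fin; toℕ; zero; suc)
import Data.Fin.Properties as Fin
open import Data.List using ([]; _∷_; _++_; concat; filter; take; length; lookup; map)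
import Data.List.Properties as List
open import Data.List.Membership.Propositional using (_∉_; find)
open import Data.List.Membership.Propositional.Properties
  using (∈-++⁺ˡ; ∈-++⁺ʳ; ∈-++⁻; ∈-map⁺; ∈-concat⁺′; ∈-filter⁺; ∈-filter⁻)
open import Data.List.Membership.DecPropositional using (_∈?_)
open import Data.List.Relation.Unary.Any using (here; there; any?; index)
import Data.List.Relation.Unary.Any as Any
open import Data.List.Relation.Unary.Any.Properties using (lookup-index)
open import Data.List.Relation.Unary.All using (All)
import Data.List.Relation.Unary.All as All
open import Data.List.Relation.Unary.All.Properties using (¬Any⇒All¬; ¬All⇒Any¬; ++⁺; map⁺)
import Data.Maybe.Relation.Unary.Any as Maybe
import Data.Product.Properties as Product
open import Data.Product using (∃; ∃₂; _,_; proj₁; proj₂)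
open import Data.Sum using (_⊎_; inj₁; inj₂; [_,_])
open import Data.Empty using (⊥-elim)
open import Function using (id; const)
open import Relation.Nullary using (yes; no; ¬?)
open import Relation.Binary.PropositionalEquality using (_≡_; _≢_; refl; sym; trans; cong; subst)
open import Relation.Binary.Definitions using (DecidableEquality)
import Data.Vec as V
import Data.Vec.Properties as V

∈-take⇒lookup : ∀ {A : Set} {x : A} (xs : List A) (m : ℕ) → x ∈ take m xs →
                ∃ λ (i : Fin (length xs)) → toℕ i ℕ.< m × lookup xs i ≡ x
∈-take⇒lookup (y ∷ ys) (ℕ.suc m) (here refl) = zero , ℕ.s≤s ℕ.z≤n , refl
∈-take⇒lookup (y ∷ ys) (ℕ.suc m) (there p) with ∈-take⇒lookup ys m p
... | i , i<m , eq = suc i , ℕ.s≤s i<m , eq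

litB≡false⇒≡not : ∀ p b → litB p b ≡ false → p ≡ not b
litB≡false⇒≡not true  false _ = refl
litB≡false⇒≡not false true  _ = refl

OpenOnU : ∀ {n} → Vec Quant n → PAsg n → Set
OpenOnU Q σ = ∀ x → V.lookup Q x ≡ ∀q → V.lookup σ x ≡ nothing

pick-∀-compat : ∀ q m b → (q ≡ ∀q → m ≡ nothing) → Compat q (pick ∀q q m b)
pick-∀-compat ∀q nothing  b _ = Maybe.just _
pick-∀-compat ∀q (just _) b open-m with () ← open-m refl
pick-∀-compat ∃q m        b _ = refl

pull-∃-openOnU : ∀ {n} (Q : Vec Quant n) α τ → OpenOnU Q (pull ∃q Q α τ)
pull-∃-openOnU Q α τ x q≡∀ = trans (V.lookup∘tabulate _ x) (pick-∃-onU q≡∀)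
  where
  pick-∃-onU : ∀ {q m b} → q ≡ ∀q → pick ∃q q m b ≡ nothing
  pick-∃-onU refl = refl

pull-∀-fullU : ∀ {n} (Q : Vec Quant n) σ ρ → OpenOnU Q σ → FullU Q (pull ∀q Q σ ρ)
pull-∀-fullU Q σ ρ open-σ x = subst (Compat (V.lookup Q x)) (sym (V.lookup∘tabulate _ x))
  (pick-∀-compat (V.lookup Q x) (V.lookup σ x) _ (open-σ x))

reached-full : ∀ {n} {Q : Vec Quant n} {φ A S} → Reached Q φ A S →
               All (FullU Q) A × All (OpenOnU Q) S
reached-full (init _ full) = full All.∷ All.[] , All.[]
reached-full {Q = Q} (step {A} {S} τ ρ r _ _) with reached-full r
... | full-A , open-S = ++⁺ full-A (map⁺ (All.map (pull-∀-fullU Q _ ρ) open-S′)) , open-S′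
  where
  open-S′ : All (OpenOnU Q) (nextS Q A S τ)
  open-S′ = ++⁺ open-S (map⁺ (All.universal (λ α → pull-∃-openOnU Q α τ) A))

module _ {n : ℕ} where

  _≟ᵛ_ : DecidableEquality (AVar n)
  _≟ᵛ_ = Product.≡-dec Fin._≟_ (List.≡-dec Bool._≟_)

  _≟ˡ_ : DecidableEquality (ALit n)
  _≟ˡ_ = Product.≡-dec Bool._≟_ _≟ᵛ_

  value : AAsg n → ALit n → Bool
  value τ (p , x) = litB p (τ x)

  _[_≔_] : AAsg n → AVar n → Bool → AAsg n
  (τ [ x ≔ b ]) y with y ≟ᵛ x
  ... | yes _ = b
  ... | no _ = τ y

  vars : List (AClause n) → List (AVar n)
  vars Γ = map proj₂ (concat Γ)

  resolvent : AVar n → AClause n → AClause n → AClause n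
  resolvent x D₁ D₂ = filter (λ l → ¬? (l ≟ˡ (true , x))) D₁
                   ++ filter (λ l → ¬? (l ≟ˡ (false , x))) D₂

  ∈-resolvent⁻ : ∀ {x l} D₁ D₂ → l ∈ resolvent x D₁ D₂ →
                 (l ∈ D₁ × l ≢ (true , x)) ⊎ (l ∈ D₂ × l ≢ (false , x))
  ∈-resolvent⁻ {x} D₁ D₂ l∈ with ∈-++⁻ (filter (λ l → ¬? (l ≟ˡ (true , x))) D₁) l∈
  ... | inj₁ l∈₁ = inj₁ (∈-filter⁻ (λ l → ¬? (l ≟ˡ (true , x))) l∈₁)
  ... | inj₂ l∈₂ = inj₂ (∈-filter⁻ (λ l → ¬? (l ≟ˡ (false , x))) l∈₂)

  resolvent-Resolvent : ∀ {x D₁ D₂} → (true , x) ∈ D₁ → (false , x) ∈ D₂ →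
                        Resolvent D₁ D₂ (resolvent x D₁ D₂)
  resolvent-Resolvent {x} {D₁} {D₂} x∈D₁ ¬x∈D₂ = x , x∈D₁ , ¬x∈D₂ , λ l →
    ∈-resolvent⁻ D₁ D₂ ,
    [ (λ (l∈ , l≢) → ∈-++⁺ˡ (∈-filter⁺ (λ l → ¬? (l ≟ˡ (true , x))) l∈ l≢))
    , (λ (l∈ , l≢) → ∈-++⁺ʳ (filter (λ l → ¬? (l ≟ˡ (true , x))) D₁)
                              (∈-filter⁺ (λ l → ¬? (l ≟ˡ (false , x))) l∈ l≢)) ]

  falsified-clause : ∀ {Γ} → Unsat Γ → (τ : AAsg n) → Any (FalsC τ) Γ
  falsified-clause {Γ} unsat τ =
    Any.map (λ ¬sat → All.map Bool.¬-not (¬Any⇒All¬ _ ¬sat))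
            (¬All⇒Any¬ (any? λ l → value τ l Bool.≟ true) Γ (λ sat → unsat (τ , sat)))

  data Derivation (Γ : List (AClause n)) : AClause n → Set where
    axiom   : ∀ {D} → D ∈ Γ → Derivation Γ D
    resolve : ∀ {D₁ D₂ D} → Derivation Γ D₁ → Derivation Γ D₂ → Resolvent D₁ D₂ D →
              Derivation Γ D

  derivation-vars : ∀ {Γ D l} → Derivation Γ D → l ∈ D → proj₂ l ∈ vars Γ
  derivation-vars (axiom D∈Γ) l∈D = ∈-map⁺ proj₂ (∈-concat⁺′ l∈D D∈Γ)
  derivation-vars (resolve d₁ d₂ (_ , _ , _ , origin)) l∈D with origin _ .proj₁ l∈D
  ... | inj₁ (l∈D₁ , _) = derivation-vars d₁ l∈D₁
  ... | inj₂ (l∈D₂ , _) = derivation-vars d₂ l∈D₂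

  FalseAvoiding : AAsg n → List (AVar n) → ALit n → Set
  FalseAvoiding τ Vs l = value τ l ≡ false × proj₂ l ∉ Vs

  FalseAvoiding-≔ : ∀ {τ x b Vs} l → FalseAvoiding (τ [ x ≔ b ]) Vs l → l ≢ (not b , x) →
                    FalseAvoiding τ (x ∷ Vs) l
  FalseAvoiding-≔ {x = x} {b} (p , y) (false-l , y∉Vs) l≢ with y ≟ᵛ x
  ... | yes refl = ⊥-elim (l≢ (cong (_, y) (litB≡false⇒≡not p b false-l)))
  ... | no y≢x = false-l , λ { (here y≡x) → y≢x y≡x ; (there y∈Vs) → y∉Vs y∈Vs }

  All-FalseAvoiding-≔ : ∀ {τ x b Vs D} → All (FalseAvoiding (τ [ x ≔ b ]) Vs) D →
                        (not b , x) ∉ D → All (FalseAvoiding τ (x ∷ Vs)) D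
  All-FalseAvoiding-≔ fa x∉D =
    All.tabulate λ l∈D → FalseAvoiding-≔ _ (All.lookup fa l∈D) λ { refl → x∉D l∈D }

  module _ {Γ : List (AClause n)} (unsat : Unsat Γ) where

    semantic-tree : ∀ Vs τ → ∃ λ D → Derivation Γ D × All (FalseAvoiding τ Vs) D
    semantic-tree [] τ with find (falsified-clause unsat τ)
    ... | D , D∈Γ , false-D = D , axiom D∈Γ , All.map (_, λ ()) false-D
    semantic-tree (x ∷ Vs) τ
      with semantic-tree Vs (τ [ x ≔ false ]) | semantic-tree Vs (τ [ x ≔ true ])
    ... | D₁ , d₁ , fa₁ | D₂ , d₂ , fa₂ with _∈?_ _≟ˡ_ (true , x) D₁
    ... | no x∉D₁ = D₁ , d₁ , All-FalseAvoiding-≔ fa₁ x∉D₁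
    ... | yes x∈D₁ with _∈?_ _≟ˡ_ (false , x) D₂
    ... | no ¬x∉D₂ = D₂ , d₂ , All-FalseAvoiding-≔ fa₂ ¬x∉D₂
    ... | yes ¬x∈D₂ =
      resolvent x D₁ D₂ , resolve d₁ d₂ (resolvent-Resolvent x∈D₁ ¬x∈D₂) ,
      All.tabulate λ l∈ → [ (λ (l∈₁ , l≢) → FalseAvoiding-≔ _ (All.lookup fa₁ l∈₁) l≢)
                          , (λ (l∈₂ , l≢) → FalseAvoiding-≔ _ (All.lookup fa₂ l∈₂) l≢) ]
                          (∈-resolvent⁻ D₁ D₂ l∈)

    resolution-complete : Derivation Γ []
    resolution-complete with semantic-tree (vars Γ) (const true)
    ... | [] , d , _ = d
    ... | l ∷ D , d , (_ , l∉vars) All.∷ _ = ⊥-elim (l∉vars (derivation-vars d (here refl)))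

module _ {n : ℕ} {Γ : List (AClause n)} where

  Step : List (AClause n) → AClause n → Set
  Step earlier D = D ∈ Γ ⊎ ∃₂ λ D₁ D₂ → D₁ ∈ earlier × D₂ ∈ earlier × Resolvent D₁ D₂ D

  data Linear (earlier : List (AClause n)) : List (AClause n) → Set where
    []  : Linear earlier []
    _∷_ : ∀ {D ds} → Step earlier D → Linear (earlier ++ D ∷ []) ds → Linear earlier (D ∷ ds)

  Linear-++ : ∀ {earlier} xs {ys} → Linear earlier xs → Linear (earlier ++ xs) ys →
              Linear earlier (xs ++ ys)
  Linear-++ {earlier} [] [] lin = subst (λ e → Linear e _) (List.++-identityʳ earlier) lin
  Linear-++ {earlier} (x ∷ xs) (s ∷ lin₁) lin₂ =
    s ∷ Linear-++ xs lin₁ (subst (λ e → Linear e _) (sym (List.++-assoc earlier (x ∷ []) xs)) lin₂)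

  linearise : ∀ {D} → Derivation Γ D → List (AClause n)
  linearise {D} (axiom _) = D ∷ []
  linearise {D} (resolve d₁ d₂ _) = linearise d₁ ++ (linearise d₂ ++ D ∷ [])

  ∈-linearise : ∀ {D} (d : Derivation Γ D) → D ∈ linearise d
  ∈-linearise (axiom _) = here refl
  ∈-linearise (resolve d₁ d₂ _) = ∈-++⁺ʳ (linearise d₁) (∈-++⁺ʳ (linearise d₂) (here refl))

  linearise-Linear : ∀ earlier {D} (d : Derivation Γ D) → Linear earlier (linearise d)
  linearise-Linear earlier (axiom D∈Γ) = inj₁ D∈Γ ∷ []
  linearise-Linear earlier (resolve {D₁} {D₂} d₁ d₂ r) =
    Linear-++ (linearise d₁) (linearise-Linear earlier d₁)
      (Linear-++ (linearise d₂) (linearise-Linear (earlier ++ linearise d₁) d₂)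
        (inj₂ (D₁ , D₂ , ∈-++⁺ˡ (∈-++⁺ʳ earlier (∈-linearise d₁)) ,
                         ∈-++⁺ʳ (earlier ++ linearise d₁) (∈-linearise d₂) , r) ∷ []))

  Linear-lookup : ∀ {earlier} ds → Linear earlier ds → ∀ k →
                  Step (earlier ++ take (toℕ k) ds) (lookup ds k)
  Linear-lookup {earlier} (D ∷ ds) (s ∷ lin) zero =
    subst (λ e → Step e D) (sym (List.++-identityʳ earlier)) s
  Linear-lookup {earlier} (D ∷ ds) (s ∷ lin) (suc k) =
    subst (λ e → Step e _) (List.++-assoc earlier (D ∷ []) (take (toℕ k) ds)) (Linear-lookup ds lin k)

AxiomInstance : ∀ {n} → Vec Quant n → CNF n → AClause n → Set
AxiomInstance {n} Q φ D = Σ (Clause n) λ C → C ∈ φ × Σ (PAsg n) λ α → FullU Q α ×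
                          Σ (AClause n) λ D′ → inst α C ≡ just D′ × D ≈c D′

refutation : ∀ {n} {Q : Vec Quant n} {φ : CNF n} {Allowed : AClause n → Set} {Γ} →
             (∀ {D} → D ∈ Γ → AxiomInstance Q φ D × Allowed D) →
             Derivation Γ [] → Σ (List (AClause n)) λ ds → Refutation Q φ Allowed ds
refutation {Q = Q} {φ} {Allowed} axioms d =
  ds , justified , index (∈-linearise d) , sym (lookup-index (∈-linearise d))
  where
  ds : List (AClause _)
  ds = linearise d
  justified : ∀ k → Justified Q φ Allowed ds k
  justified k with Linear-lookup ds (linearise-Linear [] d) k
  ... | inj₁ D∈Γ with axioms D∈Γ
  ...   | (C , C∈φ , α , full , D′ , eq , D≈D′) , allowed = axiom C C∈φ α full D′ eq D≈D′ allowed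
  justified k | inj₂ (_ , _ , D₁∈ , D₂∈ , r)
    with ∈-take⇒lookup ds (toℕ k) D₁∈ | ∈-take⇒lookup ds (toℕ k) D₂∈
  ... | i , i<k , refl | j , j<k , refl = resolution i j i<k j<k r

proposition1 : ∀ {n} (Q : Vec Quant n) (φ : CNF n) → IsFalseQBF Q φ →
    (A S : List (PAsg n)) → Reached Q φ A S →
    (ψ' : List (AClause n)) →
    (∀ D' → D' ∈ ψ' → Σ (AClause n) λ D → InExp φ A D × D' ≈c D) →
    Unsat ψ' →
    Σ (List (AClause n)) λ ds → Refutation Q φ (λ D → Any (D ≈c_) ψ') ds
proposition1 Q φ _ A S reached ψ' core unsat = refutation axioms (resolution-complete unsat)
  where
  axioms : ∀ {D} → D ∈ ψ' → AxiomInstance Q φ D × Any (D ≈c_) ψ'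
  axioms {D} D∈ψ' with core D D∈ψ'
  ... | D′ , (α , α∈A , C , C∈φ , eq) , D≈D′ =
    (C , C∈φ , α , All.lookup (reached-full reached .proj₁) α∈A , D′ , eq , D≈D′) ,
    Any.map (λ { refl _ → id , id }) D∈ψ'
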